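{- Let $t$ be an odd positive integer and $\pi$ a $t$-core. Let $n_i=r_i(\pi,t)-r_{i+1}(\pi,t)$ for $0\le i\le t-2$ and $n_{t-1}=r_{t-1}(\pi,t)-r_0(\pi,t)$. Then $$\mathrm{BG\text{ - }rank}(\pi)=\frac{1-\sum_{j=0}^{t-1}(-1)^{j+n_j}}{4}.$$
   Context: For a partition $\pi=(\lambda_1\ge\lambda_2\ge\cdots)$ (with $\lambda_i=0$ beyond the number of parts), $\mathrm{BG\text{ - }rank}(\pi)=\sum_{j\ge1}(-1)^{j+1}\frac{1-(-1)^{\lambda_j}}{2}$. A $t$-core is a partition whose Young diagram has no rim hook of length $t$. The $t$-residue diagram of $\pi$ labels the cell in row $i$ and column $j$ by the least nonnegative integer congruent to $j-i$ modulo $t$; $r_i(\pi,t)$ is the number of cells labelled $i$. -}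

module Defs where

open import Data.Nat using (ℕ; zero; suc; _<_; _≤_; _∸_; _%_; NonZero)
open import Data.Nat.Properties using (_<?_)
open import Data.Integer as ℤ using (ℤ; +_)
open import Data.List using (List; []; _∷_; length; map; upTo)
open import Data.Nat.ListAction using (sum)
open import Data.List.Relation.Unary.All using (All)
open import Data.List.Relation.Unary.Linked using (Linked)
open import Data.Integer.DivMod using (_%ℕ_)
open import Data.Product using (_×_; Σ; ∃; _,_)
open import Data.Sum using (_⊎_)
open import Relation.Binary.PropositionalEquality using (_≡_)
open import Relation.Nullary using (¬_; yes; no)

record Partition : Set where
  constructor mkPartition
  field
    parts      : List ℕ
    decreasing : Linked (λ a b → b ≤ a) parts
    positive   : All (λ a → 0 < a) parts
open Partition public

-- i-th part (0-indexed), 0 beyond the number of parts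
part : List ℕ → ℕ → ℕ
part []       _       = 0
part (x ∷ _)  zero    = x
part (_ ∷ xs) (suc i) = part xs i

-- cell in row i, column j (both 0-indexed)
_∋cell_ : Partition → ℕ × ℕ → Set
π ∋cell (i , j) = j < part (parts π) i

size : Partition → ℕ
size π = sum (parts π)

_⊆ₚ_ : Partition → Partition → Set
μ ⊆ₚ π = ∀ i → part (parts μ) i ≤ part (parts π) i

InSkew : Partition → Partition → ℕ × ℕ → Set
InSkew π μ c = (π ∋cell c) × ¬ (μ ∋cell c)

Adjacent : ℕ × ℕ → ℕ × ℕ → Set
Adjacent (i , j) (k , l) =
    (i ≡ k × suc j ≡ l) ⊎ (i ≡ k × j ≡ suc l)
  ⊎ (suc i ≡ k × j ≡ l) ⊎ (i ≡ suc k × j ≡ l)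

data Reach (S : ℕ × ℕ → Set) : ℕ × ℕ → ℕ × ℕ → Set where
  here : ∀ {c} → S c → Reach S c c
  step : ∀ {c d e} → S c → Adjacent c d → Reach S d e → Reach S c e

IsRimHook : Partition → Partition → ℕ → Set
IsRimHook π μ t =
    (μ ⊆ₚ π)
  × (size π ≡ size μ Data.Nat.+ t)
  × (∀ c d → InSkew π μ c → InSkew π μ d → Reach (InSkew π μ) c d)
  × (∀ i j → ¬ (InSkew π μ (i , j) × InSkew π μ (suc i , j)
                × InSkew π μ (i , suc j) × InSkew π μ (suc i , suc j)))

HasRimHook : Partition → ℕ → Set
HasRimHook π t = Σ Partition (λ μ → IsRimHook π μ t)

IsCore : ℕ → Partition → Set
IsCore t π = ¬ HasRimHook π t

-- BG-rank: Σ_{j≥1} (-1)^{j+1} (λ_j mod 2), j 1-indexed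
bgAux : ℕ → List ℕ → ℤ
bgAux _ [] = + 0
bgAux zero    (x ∷ xs) = (+ (x % 2)) ℤ.+ bgAux 1 xs
bgAux (suc _) (x ∷ xs) = (ℤ.- (+ (x % 2))) ℤ.+ bgAux 0 xs

BGrank : Partition → ℤ
BGrank π = bgAux 0 (parts π)

-- residue of cell (row a, column b) (1-indexed): (b - a) mod t, least nonnegative
residue : (t : ℕ) .{{_ : NonZero t}} → ℕ → ℕ → ℕ
residue t a b = ((+ b) ℤ.- (+ a)) %ℕ t

count : {A : Set} → (A → ℕ) → ℕ → List A → ℕ
count f r [] = 0
count f r (x ∷ xs) with f x Data.Nat.≟ r
... | yes _ = suc (count f r xs)
... | no  _ = count f r xs

rowCells : ℕ → ℕ → List (ℕ × ℕ)   -- row a (1-indexed) with λ_a cells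
rowCells a len = map (λ j → (a , suc j)) (upTo len)

allCells : ℕ → List ℕ → List (ℕ × ℕ)
allCells _ [] = []
allCells a (x ∷ xs) = rowCells a x Data.List.++ allCells (suc a) xs

r : (t : ℕ) .{{_ : NonZero t}} → Partition → ℕ → ℕ
r t π i = count (λ { (a , b) → residue t a b }) i (allCells 1 (parts π))

sgn : ℤ → ℤ
sgn k with ℤ.∣ k ∣ % 2
... | zero = + 1
... | suc _ = ℤ.- (+ 1)

nDiff : (t : ℕ) .{{_ : NonZero t}} → Partition → ℕ → ℤ
nDiff t π i with suc i <? t
... | yes _ = (+ r t π i) ℤ.- (+ r t π (suc i))
... | no  _ = (+ r t π i) ℤ.- (+ r t π 0)

sumℤ : List ℤ → ℤ
sumℤ [] = + 0
sumℤ (x ∷ xs) = x ℤ.+ sumℤ xs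

{-# OPTIONS --safe #-}
module Submission where

-- Put the β-numbers λ_j − j of π on an abacus with t runners. Since π has no rim
-- hook of length t, every bead has another bead t positions below it, so runner i
-- is filled exactly below a level L_i, and counting residues row by row gives
-- L_i = i + n_i t. Stacking the rows one at a time, each new bead lands on top of
-- its runner and raises that level by t; for odd t this flips the sign of exactly
-- one term of Σ_i (−1)^{L_i}. Following the sum from the last row up gives
-- Σ_i (−1)^{L_i} = 1 − 4·BG-rank, while (−1)^{L_i} = (−1)^{i + n_i} as t is odd.

open import Defs
open import Data.Nat as ℕ using (ℕ; zero; suc; NonZero; z≤n; s≤s; _%_)
import Data.Nat.Properties as ℕ
import Data.Nat.DivMod as ℕ
open import Data.List using (List; []; _∷_; length; map; upTo; _++_; [_])
import Data.List.Properties as List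
open import Data.List.Relation.Unary.Linked as Linked using (Linked)
open import Data.Product using (∃-syntax; _×_; _,_; proj₁; proj₂)
open import Data.Sum using (_⊎_; inj₁; inj₂)
open import Data.Empty using (⊥-elim)
open import Function using (_∘_; _⇔_; mk⇔; Equivalence)
import Function.Properties.Equivalence as ⇔
open import Relation.Binary.PropositionalEquality hiding ([_])
open import Relation.Binary.Definitions using (tri<; tri≈; tri>)
open import Relation.Nullary using (¬_; Dec; yes; no)

module RimHooks where
  open import Data.Nat
  open import Data.Nat.Properties
  import Data.Nat.Tactic.RingSolver as ℕ-Ring
  open import Data.Nat.ListAction using (sum)
  open import Data.List.Relation.Unary.All using (All; []; _∷_)
  open import Data.List.Relation.Unary.Linked using ([]; [-]; _∷_)
  open import Relation.Unary using (Decidable)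

  Decreasing : (ℕ → ℕ) → Set
  Decreasing f = ∀ k → f (suc k) ≤ f k

  decreasing-≤ : ∀ {f} → Decreasing f → ∀ {j k} → j ≤ k → f k ≤ f j
  decreasing-≤ dec {k = zero}  z≤n = ≤-refl
  decreasing-≤ dec {k = suc k} j≤1+k with m≤n⇒m<n∨m≡n j≤1+k
  ... | inj₂ refl  = ≤-refl
  ... | inj₁ j<1+k = ≤-trans (dec k) (decreasing-≤ dec (s≤s⁻¹ j<1+k))

  part-decreasing : ∀ {xs} → Linked (λ a b → b ≤ a) xs → Decreasing (part xs)
  part-decreasing []              _       = z≤n
  part-decreasing [-]             _       = z≤n
  part-decreasing (y≤x ∷ _)       zero    = y≤x
  part-decreasing (_ ∷ linked)    (suc k) = part-decreasing linked k

  part-beyond : ∀ xs {k} → length xs ≤ k → part xs k ≡ 0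
  part-beyond []       _         = refl
  part-beyond (x ∷ xs) (s≤s len) = part-beyond xs len

  sumUpTo : ℕ → (ℕ → ℕ) → ℕ
  sumUpTo zero    f = 0
  sumUpTo (suc n) f = f 0 + sumUpTo n (f ∘ suc)

  sumUpTo-cong : ∀ n {f g} → (∀ k → f k ≡ g k) → sumUpTo n f ≡ sumUpTo n g
  sumUpTo-cong zero    f≗g = refl
  sumUpTo-cong (suc n) f≗g = cong₂ _+_ (f≗g 0) (sumUpTo-cong n (f≗g ∘ suc))

  sum≡sumUpTo-part : ∀ xs {n} → length xs ≤ n → sum xs ≡ sumUpTo n (part xs)
  sum≡sumUpTo-part []       {zero}  _         = refl
  sum≡sumUpTo-part []       {suc n} _         = sum≡sumUpTo-part [] {n} z≤n
  sum≡sumUpTo-part (x ∷ xs) {suc n} (s≤s len) = cong (x +_) (sum≡sumUpTo-part xs len)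

  profileParts : (ℕ → ℕ) → ℕ → List ℕ
  profileParts f zero = []
  profileParts f (suc n) with f 0 ≟ 0
  ... | yes _ = []
  ... | no  _ = f 0 ∷ profileParts (f ∘ suc) n

  decreasing-vanishes : ∀ {f} → Decreasing f → f 0 ≡ 0 → ∀ k → f k ≡ 0
  decreasing-vanishes {f} dec f0≡0 k = n≤0⇒n≡0 (subst (f k ≤_) f0≡0 (decreasing-≤ dec z≤n))

  part-profileParts : ∀ {f} n → Decreasing f → f n ≡ 0 → ∀ k → part (profileParts f n) k ≡ f k
  part-profileParts zero dec fn≡0 k = sym (decreasing-vanishes dec fn≡0 k)
  part-profileParts {f} (suc n) dec fn≡0 k with f 0 ≟ 0
  ... | yes f0≡0 = sym (decreasing-vanishes dec f0≡0 k)
  part-profileParts (suc n) dec fn≡0 zero    | no _ = refl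
  part-profileParts (suc n) dec fn≡0 (suc k) | no _ = part-profileParts n (dec ∘ suc) fn≡0 k

  profileParts-linked : ∀ {f} n → Decreasing f → Linked (λ a b → b ≤ a) (profileParts f n)
  profileParts-linked zero dec = []
  profileParts-linked {f} (suc n) dec with f 0 ≟ 0
  ... | yes _ = []
  ... | no  _ = below (f 0) n (dec ∘ suc) (dec 0)
    where
    below : ∀ {g} x n → Decreasing g → g 0 ≤ x → Linked (λ a b → b ≤ a) (x ∷ profileParts g n)
    below x zero    _   _     = [-]
    below {g} x (suc n) dec g0≤x with g 0 ≟ 0
    ... | yes _ = [-]
    ... | no  _ = g0≤x ∷ below (g 0) n (dec ∘ suc) (dec 0)

  profileParts-positive : ∀ f n → All (0 <_) (profileParts f n)
  profileParts-positive f zero = []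
  profileParts-positive f (suc n) with f 0 ≟ 0
  ... | yes _    = []
  ... | no  f0≢0 = n≢0⇒n>0 f0≢0 ∷ profileParts-positive (f ∘ suc) n

  length-profileParts : ∀ f n → length (profileParts f n) ≤ n
  length-profileParts f zero = z≤n
  length-profileParts f (suc n) with f 0 ≟ 0
  ... | yes _ = z≤n
  ... | no  _ = s≤s (length-profileParts (f ∘ suc) n)

  fromProfile : (f : ℕ → ℕ) → ℕ → Decreasing f → Partition
  fromProfile f n dec = mkPartition (profileParts f n) (profileParts-linked n dec) (profileParts-positive f n)

  -- The profile p with the rim hook from the end of row i to the cell (i′, c) removed:
  -- the rows i ≤ k < i′ become p (k + 1) ∸ 1 and row i′ becomes c (junk if i′ < i).
  rimHookRemoved : (ℕ → ℕ) → (i i′ c : ℕ) → ℕ → ℕ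
  rimHookRemoved p (suc i) (suc i′) c zero    = p 0
  rimHookRemoved p (suc i) (suc i′) c (suc k) = rimHookRemoved (p ∘ suc) i i′ c k
  rimHookRemoved p (suc i) zero     c k       = p k
  rimHookRemoved p zero    (suc i′) c zero    = p 1 ∸ 1
  rimHookRemoved p zero    (suc i′) c (suc k) = rimHookRemoved (p ∘ suc) zero i′ c k
  rimHookRemoved p zero    zero     c zero    = c
  rimHookRemoved p zero    zero     c (suc k) = p (suc k)

  rimHookRemoved-above : ∀ p {i i′ c k} → i ≤ i′ → k < i → rimHookRemoved p i i′ c k ≡ p k
  rimHookRemoved-above p {suc i} {suc i′} {k = zero}  _          _         = refl
  rimHookRemoved-above p {suc i} {suc i′} {k = suc k} (s≤s i≤i′) (s≤s k<i) =
    rimHookRemoved-above (p ∘ suc) i≤i′ k<i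

  rimHookRemoved-inside : ∀ p {i i′ c k} → i ≤ k → k < i′ → rimHookRemoved p i i′ c k ≡ p (suc k) ∸ 1
  rimHookRemoved-inside p {zero}  {suc i′} {k = zero}  _         _          = refl
  rimHookRemoved-inside p {zero}  {suc i′} {k = suc k} _         (s≤s k<i′) =
    rimHookRemoved-inside (p ∘ suc) z≤n k<i′
  rimHookRemoved-inside p {suc i} {suc i′} {k = suc k} (s≤s i≤k) (s≤s k<i′) =
    rimHookRemoved-inside (p ∘ suc) i≤k k<i′

  rimHookRemoved-bottom : ∀ p {i i′ c} → i ≤ i′ → rimHookRemoved p i i′ c i′ ≡ c
  rimHookRemoved-bottom p {zero}  {zero}   _          = refl
  rimHookRemoved-bottom p {zero}  {suc i′} _          = rimHookRemoved-bottom (p ∘ suc) {zero} {i′} z≤n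
  rimHookRemoved-bottom p {suc i} {suc i′} (s≤s i≤i′) = rimHookRemoved-bottom (p ∘ suc) i≤i′

  rimHookRemoved-below : ∀ p {i i′ c k} → i ≤ i′ → i′ < k → rimHookRemoved p i i′ c k ≡ p k
  rimHookRemoved-below p {zero}  {zero}   {k = suc k} _          _          = refl
  rimHookRemoved-below p {zero}  {suc i′} {k = suc k} _          (s≤s i′<k) =
    rimHookRemoved-below (p ∘ suc) {zero} {i′} z≤n i′<k
  rimHookRemoved-below p {suc i} {suc i′} {k = suc k} (s≤s i≤i′) (s≤s i′<k) =
    rimHookRemoved-below (p ∘ suc) i≤i′ i′<k

  -- The hypothesis c < p k keeps the truncated subtractions p (k + 1) ∸ 1 exact.
  sumUpTo-rimHookRemoved : ∀ p {i i′ c N} → i ≤ i′ → i′ < N → (∀ k → k ≤ i′ → c < p k) →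
    sumUpTo N p + c + i ≡ sumUpTo N (rimHookRemoved p i i′ c) + p i + i′
  sumUpTo-rimHookRemoved p {zero} {zero} {c} {suc N} _ _ _ = swap (p 0) c (sumUpTo N (p ∘ suc))
    where
    swap : ∀ a b s → a + s + b + 0 ≡ b + s + a + 0
    swap = ℕ-Ring.solve-∀
  sumUpTo-rimHookRemoved p {zero} {suc i′} {c} {suc (suc N)} _ (s≤s i′<N) c<p = begin
    p 0 + S + c + 0
      ≡⟨ assoc (p 0) c S ⟩
    p 0 + (S + c + 0)
      ≡⟨ cong (p 0 +_) (sumUpTo-rimHookRemoved (p ∘ suc) z≤n i′<N c<p-tail) ⟩
    p 0 + (S′ + p 1 + i′)
      ≡⟨ cong (λ e → p 0 + (S′ + e + i′)) (m∸n+n≡m 1≤p1) ⟨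
    p 0 + (S′ + (p 1 ∸ 1 + 1) + i′)
      ≡⟨ regroup (p 0) (p 1 ∸ 1) S′ i′ ⟩
    p 1 ∸ 1 + S′ + p 0 + suc i′ ∎
    where
    open ≡-Reasoning
    S = sumUpTo (suc N) (p ∘ suc)
    S′ = sumUpTo (suc N) (rimHookRemoved (p ∘ suc) zero i′ c)
    c<p-tail : ∀ k → k ≤ i′ → c < p (suc k)
    c<p-tail k k≤i′ = c<p (suc k) (s≤s k≤i′)
    1≤p1 : 1 ≤ p 1
    1≤p1 = ≤-trans (s≤s z≤n) (c<p 1 (s≤s z≤n))
    assoc : ∀ a c s → a + s + c + 0 ≡ a + (s + c + 0)
    assoc = ℕ-Ring.solve-∀
    regroup : ∀ a q s i → a + (s + (q + 1) + i) ≡ q + s + a + suc i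
    regroup = ℕ-Ring.solve-∀
  sumUpTo-rimHookRemoved p {suc i} {suc i′} {c} {suc N} (s≤s i≤i′) (s≤s i′<N) c<p = begin
    p 0 + S + c + suc i
      ≡⟨ assoc (p 0) c i S ⟩
    suc (p 0 + (S + c + i))
      ≡⟨ cong (λ e → suc (p 0 + e)) (sumUpTo-rimHookRemoved (p ∘ suc) i≤i′ i′<N c<p-tail) ⟩
    suc (p 0 + (S′ + p (suc i) + i′))
      ≡⟨ assoc′ (p 0) (p (suc i)) i′ S′ ⟩
    p 0 + S′ + p (suc i) + suc i′ ∎
    where
    open ≡-Reasoning
    S = sumUpTo N (p ∘ suc)
    S′ = sumUpTo N (rimHookRemoved (p ∘ suc) i i′ c)
    c<p-tail : ∀ k → k ≤ i′ → c < p (suc k)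
    c<p-tail k k≤i′ = c<p (suc k) (s≤s k≤i′)
    assoc : ∀ a c i s → a + s + c + suc i ≡ suc (a + (s + c + i))
    assoc = ℕ-Ring.solve-∀
    assoc′ : ∀ a b i s → suc (a + (s + b + i)) ≡ a + s + b + suc i
    assoc′ = ℕ-Ring.solve-∀

  reach-start : ∀ {S c d} → Reach S c d → S c
  reach-start (here s)     = s
  reach-start (step s _ _) = s

  reach-trans : ∀ {S c d e} → Reach S c d → Reach S d e → Reach S c e
  reach-trans (here _)         r = r
  reach-trans (step s adj r′)  r = step s adj (reach-trans r′ r)

  adjacent-sym : ∀ {c d} → Adjacent c d → Adjacent d c
  adjacent-sym (inj₁ (refl , refl))                 = inj₂ (inj₁ (refl , refl))
  adjacent-sym (inj₂ (inj₁ (refl , refl)))          = inj₁ (refl , refl)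
  adjacent-sym (inj₂ (inj₂ (inj₁ (refl , refl))))   = inj₂ (inj₂ (inj₂ (refl , refl)))
  adjacent-sym (inj₂ (inj₂ (inj₂ (refl , refl))))   = inj₂ (inj₂ (inj₁ (refl , refl)))

  reach-sym : ∀ {S c d} → Reach S c d → Reach S d c
  reach-sym (here s)       = here s
  reach-sym (step s adj r) = reach-trans (reach-sym r) (step (reach-start r) (adjacent-sym adj) (here s))

  -- The rim hook that starts at the last cell of row `top` and ends at the cell
  -- (`bottom`, `column`); `hook-length` says that it has t cells.
  record RimHookSpan (xs : List ℕ) (t : ℕ) : Set where
    field
      top bottom column : ℕ
      top≤bottom    : top ≤ bottom
      next≤column   : part xs (suc bottom) ≤ column
      column<bottom : column < part xs bottom
      hook-length   : part xs top + bottom ≡ t + column + top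

  module RimHookRemoval {π : Partition} {t : ℕ} (h : RimHookSpan (parts π) t) where
    open RimHookSpan h

    p : ℕ → ℕ
    p = part (parts π)

    p-decreasing : Decreasing p
    p-decreasing = part-decreasing (decreasing π)

    μ : ℕ → ℕ
    μ = rimHookRemoved p top bottom column

    data Zone (k : ℕ) : Set where
      above     : k < top → Zone k
      inside    : top ≤ k → k < bottom → Zone k
      at-bottom : k ≡ bottom → Zone k
      below     : bottom < k → Zone k

    zone : ∀ k → Zone k
    zone k with <-cmp k bottom
    ... | tri> _ _ bottom<k = below bottom<k
    ... | tri≈ _ k≡bottom _ = at-bottom k≡bottom
    ... | tri< k<bottom _ _ with k <? top
    ...   | yes k<top = above k<top
    ...   | no  k≮top = inside (≮⇒≥ k≮top) k<bottom

    μ-above : ∀ {k} → k < top → μ k ≡ p k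
    μ-above = rimHookRemoved-above p top≤bottom

    μ-inside : ∀ {k} → top ≤ k → k < bottom → μ k ≡ p (suc k) ∸ 1
    μ-inside = rimHookRemoved-inside p

    μ-bottom : μ bottom ≡ column
    μ-bottom = rimHookRemoved-bottom p top≤bottom

    μ-below : ∀ {k} → bottom < k → μ k ≡ p k
    μ-below = rimHookRemoved-below p top≤bottom

    column<p : ∀ {k} → k ≤ bottom → column < p k
    column<p k≤bottom = <-≤-trans column<bottom (decreasing-≤ p-decreasing k≤bottom)

    ∸1< : ∀ {n} → 0 < n → n ∸ 1 < n
    ∸1< {suc n} _ = n<1+n n

    μ≤p : ∀ k → μ k ≤ p k
    μ≤p k with zone k
    ... | above k<top          = ≤-reflexive (μ-above k<top)
    ... | inside top≤k k<bottom = begin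
      μ k             ≡⟨ μ-inside top≤k k<bottom ⟩
      p (suc k) ∸ 1   ≤⟨ m∸n≤m (p (suc k)) 1 ⟩
      p (suc k)       ≤⟨ p-decreasing k ⟩
      p k             ∎
      where open ≤-Reasoning
    ... | at-bottom refl       = ≤-trans (≤-reflexive μ-bottom) (<⇒≤ column<bottom)
    ... | below bottom<k       = ≤-reflexive (μ-below bottom<k)

    μ-decreasing : Decreasing μ
    μ-decreasing k with zone k
    ... | above k<top = ≤-trans (μ≤p (suc k)) (≤-trans (p-decreasing k) (≤-reflexive (sym (μ-above k<top))))
    ... | at-bottom refl = subst₂ _≤_ (sym (μ-below (n<1+n bottom))) (sym μ-bottom) next≤column
    ... | below bottom<k = subst₂ _≤_ (sym (μ-below (m<n⇒m<1+n bottom<k))) (sym (μ-below bottom<k)) (p-decreasing k)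
    ... | inside top≤k k<bottom with <-cmp (suc k) bottom
    ...   | tri< 1+k<bottom _ _ =
      subst₂ _≤_ (sym (μ-inside (m≤n⇒m≤1+n top≤k) 1+k<bottom)) (sym (μ-inside top≤k k<bottom))
                 (∸-monoˡ-≤ 1 (p-decreasing (suc k)))
    ...   | tri≈ _ refl _ = subst₂ _≤_ (sym μ-bottom) (sym (μ-inside top≤k k<bottom)) (<⇒≤pred column<bottom)
    ...   | tri> _ _ bottom<1+k = ⊥-elim (<⇒≱ bottom<1+k k<bottom)

    N : ℕ
    N = length (parts π) + suc bottom

    removed : Partition
    removed = fromProfile μ N μ-decreasing

    part-removed : ∀ k → part (parts removed) k ≡ μ k
    part-removed = part-profileParts N μ-decreasing
      (trans (μ-below (m≤n+m (suc bottom) (length (parts π)))) (part-beyond (parts π) (m≤m+n _ _)))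

    removed⊆π : removed ⊆ₚ π
    removed⊆π k = ≤-trans (≤-reflexive (part-removed k)) (μ≤p k)

    size-removed : size π ≡ size removed + t
    size-removed = +-cancelʳ-≡ (column + top) _ _ (begin
      size π + (column + top)
        ≡⟨ cong (λ s → s + (column + top)) size-π ⟩
      sumUpTo N p + (column + top)
        ≡⟨ +-assoc (sumUpTo N p) column top ⟨
      sumUpTo N p + column + top
        ≡⟨ sumUpTo-rimHookRemoved p top≤bottom (m≤n+m (suc bottom) (length (parts π))) (λ _ → column<p) ⟩
      sumUpTo N μ + p top + bottom
        ≡⟨ +-assoc (sumUpTo N μ) (p top) bottom ⟩
      sumUpTo N μ + (p top + bottom)
        ≡⟨ cong (sumUpTo N μ +_) hook-length ⟩
      sumUpTo N μ + (t + column + top)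
        ≡⟨ regroup (sumUpTo N μ) t column top ⟩
      sumUpTo N μ + t + (column + top)
        ≡⟨ cong (λ s → s + t + (column + top)) size-removed′ ⟨
      size removed + t + (column + top)     ∎)
      where
      open ≡-Reasoning
      size-π : size π ≡ sumUpTo N p
      size-π = sum≡sumUpTo-part (parts π) (m≤m+n _ _)
      size-removed′ : size removed ≡ sumUpTo N μ
      size-removed′ = trans (sum≡sumUpTo-part (parts removed) (length-profileParts μ N))
                            (sumUpTo-cong N part-removed)
      regroup : ∀ a b c d → a + (b + c + d) ≡ a + b + (c + d)
      regroup = ℕ-Ring.solve-∀

    S : ℕ × ℕ → Set
    S = InSkew π removed

    ⇒skew : ∀ {k j} → μ k ≤ j → j < p k → S (k , j)
    ⇒skew {k} {j} μ≤j j<p = j<p , λ j<μ → <⇒≱ (subst (j <_) (part-removed k) j<μ) μ≤j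

    skew⇒μ≤ : ∀ {k j} → S (k , j) → μ k ≤ j
    skew⇒μ≤ {k} {j} (_ , j≮μ) = subst (_≤ j) (part-removed k) (≮⇒≥ j≮μ)

    skew-rows : ∀ {k j} → S (k , j) → top ≤ k × k ≤ bottom
    skew-rows {k} s with zone k
    ... | above k<top           = ⊥-elim (<⇒≱ (proj₁ s) (subst (_≤ _) (μ-above k<top) (skew⇒μ≤ s)))
    ... | inside top≤k k<bottom = top≤k , <⇒≤ k<bottom
    ... | at-bottom refl        = top≤bottom , ≤-refl
    ... | below bottom<k        = ⊥-elim (<⇒≱ (proj₁ s) (subst (_≤ _) (μ-below bottom<k) (skew⇒μ≤ s)))

    along-row : ∀ {k lo j e} → μ k ≤ lo → lo ≤ j → j < p k → Reach S (k , lo) e → Reach S (k , j) e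
    along-row {k} {lo} {j} μ≤lo lo≤j j<p r with m≤n⇒m<n∨m≡n lo≤j
    ... | inj₂ refl = r
    along-row {j = suc j} μ≤lo _ 1+j<p r | inj₁ lo<1+j =
      step (⇒skew (≤-trans μ≤lo (<⇒≤ lo<1+j)) 1+j<p) (inj₂ (inj₁ (refl , refl)))
           (along-row μ≤lo (s≤s⁻¹ lo<1+j) (<-trans (n<1+n j) 1+j<p) r)

    corner : ℕ × ℕ
    corner = bottom , column

    reach-corner : ∀ m {k j} → k + m ≡ bottom → S (k , j) → Reach S (k , j) corner
    reach-corner zero {k} {j} k+0≡bottom s with trans (sym (+-identityʳ k)) k+0≡bottom
    ... | refl = along-row (≤-reflexive μ-bottom) (subst (_≤ j) μ-bottom (skew⇒μ≤ s)) (proj₁ s)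
                   (here (⇒skew (≤-reflexive μ-bottom) column<bottom))
    reach-corner (suc m) {k} {j} k+1+m≡bottom s =
      along-row ≤-refl (skew⇒μ≤ s) (proj₁ s)
        (step (⇒skew ≤-refl (<-≤-trans μk<p1+k (p-decreasing k))) (inj₂ (inj₂ (inj₁ (refl , refl))))
              (reach-corner m (trans (sym (+-suc k m)) k+1+m≡bottom) (⇒skew (μ-decreasing k) μk<p1+k)))
      where
      k<bottom : k < bottom
      k<bottom = subst (k <_) k+1+m≡bottom (m<m+n k (s≤s z≤n))
      μk<p1+k : μ k < p (suc k)
      μk<p1+k = subst (_< p (suc k)) (sym (μ-inside (proj₁ (skew-rows s)) k<bottom))
                      (∸1< (<-≤-trans (s≤s z≤n) (column<p k<bottom)))

    connected : ∀ c d → S c → S d → Reach S c d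
    connected c d sc sd = reach-trans (to-corner sc) (reach-sym (to-corner sd))
      where
      to-corner : ∀ {c} → S c → Reach S c corner
      to-corner {k , j} s = reach-corner (bottom ∸ k) (m+[n∸m]≡n (proj₂ (skew-rows s))) s

    no-square : ∀ k j → ¬ (S (k , j) × S (suc k , j) × S (k , suc j) × S (suc k , suc j))
    no-square k j (s , _ , _ , s′) = <⇒≱ (proj₁ s′) (begin
      p (suc k)             ≡⟨ m∸n+n≡m 1≤p ⟨
      p (suc k) ∸ 1 + 1     ≡⟨ cong (_+ 1) (μ-inside (proj₁ (skew-rows s)) (proj₂ (skew-rows s′))) ⟨
      μ k + 1               ≤⟨ +-monoˡ-≤ 1 (skew⇒μ≤ s) ⟩
      j + 1                 ≡⟨ +-comm j 1 ⟩
      suc j                 ∎)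
      where
      open ≤-Reasoning
      1≤p : 1 ≤ p (suc k)
      1≤p = <-≤-trans (s≤s z≤n) (column<p (proj₂ (skew-rows s′)))

    isRimHook : IsRimHook π removed t
    isRimHook = removed⊆π , size-removed , connected , no-square

  rimHookSpan⇒hasRimHook : ∀ {π t} → RimHookSpan (parts π) t → HasRimHook π t
  rimHookSpan⇒hasRimHook {π} {t} h = removed , isRimHook
    where open RimHookRemoval {π} {t} h

  ¬RimHookSpan-∷ : ∀ {x xs t} → ¬ RimHookSpan (x ∷ xs) t → ¬ RimHookSpan xs t
  ¬RimHookSpan-∷ {x} {xs} {t} no-span h = no-span (record
    { top           = suc top
    ; bottom        = suc bottom
    ; column        = column
    ; top≤bottom    = s≤s top≤bottom
    ; next≤column   = next≤column
    ; column<bottom = column<bottom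
    ; hook-length   = trans (+-suc _ bottom) (trans (cong suc hook-length) (sym (+-suc (t + column) top)))
    })
    where open RimHookSpan h

  firstFailure : ∀ {P : ℕ → Set} → Decidable P → P 0 → ∀ {n} → ¬ P n → ∃[ k ] P k × ¬ P (suc k)
  firstFailure P? p0 {zero}  ¬p0 = ⊥-elim (¬p0 p0)
  firstFailure P? p0 {suc n} ¬p1+n with P? n
  ... | yes pn = n , pn , ¬p1+n
  ... | no ¬pn = firstFailure P? p0 ¬pn

  -- Let k be the last row whose bead lies above x − t. Either the bead of row k + 1
  -- sits exactly at x − t, or the rim hook from the end of row 0 down to row k has t cells.
  ¬RimHookSpan⇒bead-below : ∀ {x xs t} → 0 < t → Linked (λ a b → b ≤ a) (x ∷ xs) →
                            ¬ RimHookSpan (x ∷ xs) t → ∃[ k ] part xs k + t ≡ x + suc k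
  ¬RimHookSpan⇒bead-below {x} {xs} {t} 0<t linked no-span =
    last-above (firstFailure (λ k → x + k <? part (x ∷ xs) k + t) x+0<x+t ¬above-t)
    where
    Above : ℕ → Set
    Above k = x + k < part (x ∷ xs) k + t

    x+0<x+t : Above 0
    x+0<x+t = +-monoʳ-< x 0<t

    ¬above-t : ¬ Above t
    ¬above-t = ≤⇒≯ (+-monoˡ-≤ t (decreasing-≤ (part-decreasing linked) {0} {t} z≤n))

    last-above : ∃[ k ] Above k × ¬ Above (suc k) → ∃[ k ] part xs k + t ≡ x + suc k
    last-above (k , above , ¬above) with m≤n⇒m<n∨m≡n (≮⇒≥ ¬above)
    ... | inj₂ on-target   = k , on-target
    ... | inj₁ below-target = ⊥-elim (no-span (record
      { top           = 0
      ; bottom        = k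
      ; column        = c
      ; top≤bottom    = z≤n
      ; next≤column   = +-cancelʳ-≤ t _ _ (subst (part xs k + t ≤_) (sym c+t≡x+k) next+t≤x+k)
      ; column<bottom = +-cancelʳ-< t _ _ (subst (_< part (x ∷ xs) k + t) (sym c+t≡x+k) above)
      ; hook-length   = trans (sym c+t≡x+k) (trans (+-comm c t) (sym (+-identityʳ (t + c))))
      }))
      where
      next+t≤x+k : part xs k + t ≤ x + k
      next+t≤x+k = s≤s⁻¹ (subst (part xs k + t <_) (+-suc x k) below-target)
      c : ℕ
      c = x + k ∸ t
      c+t≡x+k : c + t ≡ x + k
      c+t≡x+k = m∸n+n≡m (≤-trans (m≤n+m t (part xs k)) next+t≤x+k)

open RimHooks

open import Data.Integer as ℤ
  using (ℤ; +_; -[1+_]; 0ℤ; 1ℤ; -1ℤ; _+_; _-_; _*_; -_; _≤_; _<_; _%ℕ_; _/ℕ_; ∣_∣)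
import Data.Integer.Properties as ℤ
open import Data.Integer.DivMod using (n%ℕd<d; a≡a%ℕn+[a/ℕn]*n)
open import Data.Integer.Tactic.RingSolver using (solve-∀)

open Equivalence using (to; from)

+-cancelˡ-< : ∀ i {j k} → i + j < i + k → j < k
+-cancelˡ-< i {j} {k} lt = subst₂ _<_ (cancel i j) (cancel i k) (ℤ.+-monoʳ-< (- i) lt)
  where
  cancel : ∀ i j → - i + (i + j) ≡ j
  cancel = solve-∀

i≤j⇒∃[n]j≡i+n : ∀ {i j} → i ≤ j → ∃[ n ] j ≡ i + + n
i≤j⇒∃[n]j≡i+n {i} {j} i≤j = ∣ j - i ∣ , (begin
  j               ≡⟨ shift i j ⟩
  i + (j - i)     ≡⟨ cong (λ e → i + e) (ℤ.0≤i⇒+∣i∣≡i (ℤ.i≤j⇒0≤j-i i≤j)) ⟨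
  i + + ∣ j - i ∣ ∎)
  where
  open ≡-Reasoning
  shift : ∀ i j → j ≡ i + (j - i)
  shift = solve-∀

i<i+[1+n] : ∀ i n → i < i + + suc n
i<i+[1+n] i n = subst (_< i + + suc n) (ℤ.+-identityʳ i) (ℤ.+-monoʳ-< i (ℤ.+<+ (s≤s z≤n)))

module _ {d : ℕ} .{{_ : NonZero d}} where

  quotient-≤ : ∀ {r r′} q q′ → r′ ℕ.< d → + r + q * + d ≤ + r′ + q′ * + d → q ≤ q′
  quotient-≤ {r} {r′} q q′ r′<d le =
    subst (q ≤_) (ℤ.pred-suc q′) (ℤ.i<j⇒i≤pred[j] {j = 1ℤ + q′} (ℤ.*-cancelʳ-<-nonNeg (+ d) lt))
    where
    open ℤ.≤-Reasoning
    factor : ∀ d q → d + q * d ≡ (1ℤ + q) * d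
    factor = solve-∀
    lt : q * + d < (1ℤ + q′) * + d
    lt = begin-strict
      q * + d          ≤⟨ ℤ.i≤j+i (q * + d) (+ r) ⟩
      + r + q * + d    ≤⟨ le ⟩
      + r′ + q′ * + d  <⟨ ℤ.+-monoˡ-< (q′ * + d) (ℤ.+<+ r′<d) ⟩
      + d + q′ * + d   ≡⟨ factor (+ d) q′ ⟩
      (1ℤ + q′) * + d  ∎

  remainder-unique : ∀ {r r′} q q′ → r ℕ.< d → r′ ℕ.< d →
                     + r + q * + d ≡ + r′ + q′ * + d → r ≡ r′
  remainder-unique {r} {r′} q q′ r<d r′<d eq = ℤ.+-injective (begin
    + r                          ≡⟨ cancel (+ r) (q * + d) ⟩
    + r + q * + d - q * + d      ≡⟨ cong (λ e → e - q * + d) eq ⟩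
    + r′ + q′ * + d - q * + d    ≡⟨ cong (λ e → + r′ + e * + d - q * + d) q′≡q ⟩
    + r′ + q * + d - q * + d     ≡⟨ cancel (+ r′) (q * + d) ⟨
    + r′                         ∎)
    where
    open ≡-Reasoning
    cancel : ∀ a b → a ≡ a + b - b
    cancel = solve-∀
    q′≡q : q′ ≡ q
    q′≡q = ℤ.≤-antisym (quotient-≤ q′ q r<d (ℤ.≤-reflexive (sym eq))) (quotient-≤ q q′ r′<d (ℤ.≤-reflexive eq))

  %ℕ-unique : ∀ {z r} q → r ℕ.< d → z ≡ + r + q * + d → z %ℕ d ≡ r
  %ℕ-unique {z} q r<d eq =
    remainder-unique (z /ℕ d) q (n%ℕd<d z d) r<d (trans (sym (a≡a%ℕn+[a/ℕn]*n z d)) eq)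

  [i+k*d]%ℕd≡i%ℕd : ∀ z q → (z + q * + d) %ℕ d ≡ z %ℕ d
  [i+k*d]%ℕd≡i%ℕd z q = %ℕ-unique (z /ℕ d + q) (n%ℕd<d z d) (begin
    z + q * + d                               ≡⟨ cong (λ e → e + q * + d) (a≡a%ℕn+[a/ℕn]*n z d) ⟩
    + (z %ℕ d) + z /ℕ d * + d + q * + d       ≡⟨ regroup (+ (z %ℕ d)) (z /ℕ d) q (+ d) ⟩
    + (z %ℕ d) + (z /ℕ d + q) * + d           ∎)
    where
    open ≡-Reasoning
    regroup : ∀ r a q d → r + a * d + q * d ≡ r + (a + q) * d
    regroup = solve-∀

  %ℕ-distrib-+ : ∀ y z → (y + z) %ℕ d ≡ (y %ℕ d ℕ.+ z %ℕ d) ℕ.% d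
  %ℕ-distrib-+ y z = %ℕ-unique (y /ℕ d + z /ℕ d + + (s ℕ./ d)) (ℕ.m%n<n s d) (begin
    y + z
      ≡⟨ cong₂ _+_ (a≡a%ℕn+[a/ℕn]*n y d) (a≡a%ℕn+[a/ℕn]*n z d) ⟩
    + (y %ℕ d) + y /ℕ d * + d + (+ (z %ℕ d) + z /ℕ d * + d)
      ≡⟨ regroup (+ (y %ℕ d)) (+ (z %ℕ d)) (y /ℕ d) (z /ℕ d) (+ d) ⟩
    + s + (y /ℕ d + z /ℕ d) * + d
      ≡⟨ cong (λ e → e + (y /ℕ d + z /ℕ d) * + d) s≡ ⟩
    + (s ℕ.% d) + + (s ℕ./ d) * + d + (y /ℕ d + z /ℕ d) * + d
      ≡⟨ regroup′ (+ (s ℕ.% d)) (+ (s ℕ./ d)) (y /ℕ d + z /ℕ d) (+ d) ⟩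
    + (s ℕ.% d) + (y /ℕ d + z /ℕ d + + (s ℕ./ d)) * + d    ∎)
    where
    open ≡-Reasoning
    s = y %ℕ d ℕ.+ z %ℕ d
    s≡ : + s ≡ + (s ℕ.% d) + + (s ℕ./ d) * + d
    s≡ = trans (cong +_ (ℕ.m≡m%n+[m/n]*n s d))
               (trans (ℤ.pos-+ (s ℕ.% d) _) (cong (λ e → + (s ℕ.% d) + e) (ℤ.pos-* (s ℕ./ d) d)))
    regroup : ∀ r r′ a b d → r + a * d + (r′ + b * d) ≡ (r + r′) + (a + b) * d
    regroup = solve-∀
    regroup′ : ∀ r c e d → r + c * d + e * d ≡ r + (e + c) * d
    regroup′ = solve-∀

  %ℕ-injective-window : ∀ {y z} → y %ℕ d ≡ z %ℕ d → z ≤ y → y < z + + d → y ≡ z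
  %ℕ-injective-window {y} {z} same z≤y y<z+d with i≤j⇒∃[n]j≡i+n z≤y
  ... | n , refl = trans (cong (λ e → z + + e) n≡0) (ℤ.+-identityʳ z)
    where
    open ≡-Reasoning
    n<d : n ℕ.< d
    n<d = ℤ.drop‿+<+ (+-cancelˡ-< z y<z+d)
    n≡0 : n ≡ 0
    n≡0 = remainder-unique 0ℤ ((z + + n) /ℕ d - z /ℕ d) n<d (ℕ.>-nonZero⁻¹ d) (begin
      + n + 0ℤ * + d
        ≡⟨ difference z (+ n) (+ d) ⟩
      z + + n - z
        ≡⟨ cong₂ _-_ (a≡a%ℕn+[a/ℕn]*n (z + + n) d) (a≡a%ℕn+[a/ℕn]*n z d) ⟩
      + ((z + + n) %ℕ d) + (z + + n) /ℕ d * + d - (+ (z %ℕ d) + z /ℕ d * + d)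
        ≡⟨ cong (λ r → + r + (z + + n) /ℕ d * + d - (+ (z %ℕ d) + z /ℕ d * + d)) same ⟩
      + (z %ℕ d) + (z + + n) /ℕ d * + d - (+ (z %ℕ d) + z /ℕ d * + d)
        ≡⟨ regroup (+ (z %ℕ d)) ((z + + n) /ℕ d) (z /ℕ d) (+ d) ⟩
      + 0 + ((z + + n) /ℕ d - z /ℕ d) * + d     ∎)
      where
      difference : ∀ z n d → n + 0ℤ * d ≡ z + n - z
      difference = solve-∀
      regroup : ∀ r a b d → r + a * d - (r + b * d) ≡ 0ℤ + (a - b) * d
      regroup = solve-∀

next : ℕ → ℕ → ℕ
next d i with suc i ℕ.<? d
... | yes _ = suc i
... | no  _ = 0

next-injective : ∀ {d u i} → u ℕ.< d → i ℕ.< d → next d u ≡ next d i → u ≡ i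
next-injective {d} {u} {i} u<d i<d eq with suc u ℕ.<? d | suc i ℕ.<? d
... | yes _   | yes _   = ℕ.suc-injective eq
... | no  u+1≮d | no i+1≮d =
  ℕ.suc-injective (trans (ℕ.≤-antisym u<d (ℕ.≮⇒≥ u+1≮d)) (sym (ℕ.≤-antisym i<d (ℕ.≮⇒≥ i+1≮d))))
... | yes _   | no  _   = ⊥-elim (ℕ.1+n≢0 eq)
... | no  _   | yes _   = ⊥-elim (ℕ.1+n≢0 (sym eq))

%ℕ-suc : ∀ {d} .{{_ : NonZero d}} z → (z + 1ℤ) %ℕ d ≡ next d (z %ℕ d)
%ℕ-suc {d} z with suc (z %ℕ d) ℕ.<? d
... | yes r+1<d = %ℕ-unique (z /ℕ d) r+1<d (begin
  z + 1ℤ                                 ≡⟨ cong (λ e → e + 1ℤ) (a≡a%ℕn+[a/ℕn]*n z d) ⟩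
  + (z %ℕ d) + z /ℕ d * + d + 1ℤ         ≡⟨ regroup (+ (z %ℕ d)) (z /ℕ d) (+ d) ⟩
  1ℤ + + (z %ℕ d) + z /ℕ d * + d         ∎)
  where
  open ≡-Reasoning
  regroup : ∀ r q d → r + q * d + 1ℤ ≡ 1ℤ + r + q * d
  regroup = solve-∀
... | no r+1≮d = %ℕ-unique (z /ℕ d + 1ℤ) (ℕ.>-nonZero⁻¹ d) (begin
  z + 1ℤ                                 ≡⟨ cong (λ e → e + 1ℤ) (a≡a%ℕn+[a/ℕn]*n z d) ⟩
  + (z %ℕ d) + z /ℕ d * + d + 1ℤ         ≡⟨ cong (λ e → + (z %ℕ d) + z /ℕ d * e + 1ℤ) d≡ ⟩
  + (z %ℕ d) + z /ℕ d * (1ℤ + + (z %ℕ d)) + 1ℤ ≡⟨ regroup (+ (z %ℕ d)) (z /ℕ d) ⟩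
  0ℤ + (z /ℕ d + 1ℤ) * (1ℤ + + (z %ℕ d)) ≡⟨ cong (λ e → 0ℤ + (z /ℕ d + 1ℤ) * e) d≡ ⟨
  0ℤ + (z /ℕ d + 1ℤ) * + d               ∎)
  where
  open ≡-Reasoning
  d≡ : + d ≡ 1ℤ + + (z %ℕ d)
  d≡ = cong +_ (sym (ℕ.≤-antisym (n%ℕd<d z d) (ℕ.≮⇒≥ r+1≮d)))
  regroup : ∀ r q → r + q * (1ℤ + r) + 1ℤ ≡ 0ℤ + (q + 1ℤ) * (1ℤ + r)
  regroup = solve-∀

δ : ℕ → ℕ → ℤ
δ i j with i ℕ.≟ j
... | yes _ = 1ℤ
... | no  _ = 0ℤ

δ-refl : ∀ i → δ i i ≡ 1ℤ
δ-refl i with i ℕ.≟ i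
... | yes _   = refl
... | no  i≢i = ⊥-elim (i≢i refl)

δ-≢ : ∀ {i j} → i ≢ j → δ i j ≡ 0ℤ
δ-≢ {i} {j} i≢j with i ℕ.≟ j
... | yes i≡j = ⊥-elim (i≢j i≡j)
... | no  _   = refl

δ-next : ∀ {d u i} → u ℕ.< d → i ℕ.< d → δ (next d u) (next d i) ≡ δ u i
δ-next {d} {u} {i} u<d i<d with u ℕ.≟ i
... | yes refl = δ-refl (next d u)
... | no  u≢i  = δ-≢ (λ eq → u≢i (next-injective u<d i<d eq))

sgn₂ : ℕ → ℤ
sgn₂ zero    = 1ℤ
sgn₂ (suc _) = -1ℤ

sgn≡sgn₂∣∣ : ∀ z → sgn z ≡ sgn₂ (∣ z ∣ ℕ.% 2)
sgn≡sgn₂∣∣ z with ∣ z ∣ ℕ.% 2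
... | zero  = refl
... | suc _ = refl

∣∣%2≡%ℕ2 : ∀ z → ∣ z ∣ ℕ.% 2 ≡ z %ℕ 2
∣∣%2≡%ℕ2 (+ n)    = refl
∣∣%2≡%ℕ2 -[1+ n ] with suc n ℕ.% 2 | ℕ.m%n<n (suc n) 2
... | 0           | _               = refl
... | 1           | _               = refl
... | suc (suc _) | s≤s (s≤s ())

sgn≡sgn₂ : ∀ z → sgn z ≡ sgn₂ (z %ℕ 2)
sgn≡sgn₂ z = trans (sgn≡sgn₂∣∣ z) (cong sgn₂ (∣∣%2≡%ℕ2 z))

sgn₂-+ : ∀ {r s} → r ℕ.< 2 → s ℕ.< 2 → sgn₂ ((r ℕ.+ s) ℕ.% 2) ≡ sgn₂ r * sgn₂ s
sgn₂-+ {0} {0} _ _ = refl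
sgn₂-+ {0} {1} _ _ = refl
sgn₂-+ {1} {0} _ _ = refl
sgn₂-+ {1} {1} _ _ = refl
sgn₂-+ {suc (suc _)} (s≤s (s≤s ())) _
sgn₂-+ {_} {suc (suc _)} _ (s≤s (s≤s ()))

sgn-+ : ∀ a b → sgn (a + b) ≡ sgn a * sgn b
sgn-+ a b = begin
  sgn (a + b)                            ≡⟨ sgn≡sgn₂ (a + b) ⟩
  sgn₂ ((a + b) %ℕ 2)                    ≡⟨ cong sgn₂ (%ℕ-distrib-+ a b) ⟩
  sgn₂ ((a %ℕ 2 ℕ.+ b %ℕ 2) ℕ.% 2)       ≡⟨ sgn₂-+ (n%ℕd<d a 2) (n%ℕd<d b 2) ⟩
  sgn₂ (a %ℕ 2) * sgn₂ (b %ℕ 2)          ≡⟨ cong₂ _*_ (sgn≡sgn₂ a) (sgn≡sgn₂ b) ⟨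
  sgn a * sgn b                          ∎
  where open ≡-Reasoning

sgn-neg : ∀ z → sgn (- z) ≡ sgn z
sgn-neg z = begin
  sgn (- z)                 ≡⟨ sgn≡sgn₂∣∣ (- z) ⟩
  sgn₂ (∣ - z ∣ ℕ.% 2)      ≡⟨ cong (λ n → sgn₂ (n ℕ.% 2)) (ℤ.∣-i∣≡∣i∣ z) ⟩
  sgn₂ (∣ z ∣ ℕ.% 2)        ≡⟨ sgn≡sgn₂∣∣ z ⟨
  sgn z                     ∎
  where open ≡-Reasoning

sgn-square : ∀ z → sgn z * sgn z ≡ 1ℤ
sgn-square z rewrite sgn≡sgn₂ z with z %ℕ 2
... | zero  = refl
... | suc _ = refl

sgn-suc : ∀ n → sgn (+ suc n) ≡ - sgn (+ n)
sgn-suc n = trans (sgn-+ 1ℤ (+ n)) (ℤ.-1*i≡-i (sgn (+ n)))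

sgn-parity : ∀ x → sgn (+ x) ≡ 1ℤ - + 2 * + (x ℕ.% 2)
sgn-parity x = trans (sgn≡sgn₂ (+ x)) (sgn₂≡ (ℕ.m%n<n x 2))
  where
  sgn₂≡ : ∀ {r} → r ℕ.< 2 → sgn₂ r ≡ 1ℤ - + 2 * + r
  sgn₂≡ {0} _ = refl
  sgn₂≡ {1} _ = refl
  sgn₂≡ {suc (suc _)} (s≤s (s≤s ()))

Σ< : ℕ → (ℕ → ℤ) → ℤ
Σ< zero    f = 0ℤ
Σ< (suc n) f = Σ< n f + f n

syntax Σ< n (λ i → e) = ∑[ i < n ] e

∑-cong : ∀ n {f g : ℕ → ℤ} → (∀ i → i ℕ.< n → f i ≡ g i) → Σ< n f ≡ Σ< n g
∑-cong zero    f≗g = refl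
∑-cong (suc n) f≗g = cong₂ _+_ (∑-cong n (λ i i<n → f≗g i (ℕ.m<n⇒m<1+n i<n))) (f≗g n ℕ.≤-refl)

∑-update : ∀ {n ρ} (f g : ℕ → ℤ) → ρ ℕ.< n → (∀ i → i ≢ ρ → g i ≡ f i) →
           Σ< n g ≡ Σ< n f + (g ρ - f ρ)
∑-update {suc n} {ρ} f g ρ<1+n g≗f with ρ ℕ.≟ n
... | yes refl = begin
  Σ< n g + g n
    ≡⟨ cong (λ e → e + g n) (∑-cong n (λ i i<n → g≗f i (λ i≡n → ℕ.<-irrefl i≡n i<n))) ⟩
  Σ< n f + g n
    ≡⟨ regroup (Σ< n f) (f n) (g n) ⟩
  Σ< n f + f n + (g n - f n)  ∎
  where
  open ≡-Reasoning
  regroup : ∀ s a b → s + b ≡ s + a + (b - a)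
  regroup = solve-∀
... | no ρ≢n = begin
  Σ< n g + g n                  ≡⟨ cong₂ _+_ (∑-update f g ρ<n g≗f) (g≗f n (λ n≡ρ → ρ≢n (sym n≡ρ))) ⟩
  Σ< n f + (g ρ - f ρ) + f n    ≡⟨ regroup (Σ< n f) (g ρ - f ρ) (f n) ⟩
  Σ< n f + f n + (g ρ - f ρ)    ∎
  where
  open ≡-Reasoning
  ρ<n : ρ ℕ.< n
  ρ<n = ℕ.≤∧≢⇒< (ℕ.s≤s⁻¹ ρ<1+n) ρ≢n
  regroup : ∀ s e a → s + e + a ≡ s + a + e
  regroup = solve-∀

sumℤ-++ : ∀ xs ys → sumℤ (xs ++ ys) ≡ sumℤ xs + sumℤ ys
sumℤ-++ []       ys = sym (ℤ.+-identityˡ (sumℤ ys))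
sumℤ-++ (x ∷ xs) ys = trans (cong (λ e → x + e) (sumℤ-++ xs ys)) (sym (ℤ.+-assoc x (sumℤ xs) (sumℤ ys)))

sumℤ-map-upTo : ∀ (f : ℕ → ℤ) n → sumℤ (map f (upTo n)) ≡ Σ< n f
sumℤ-map-upTo f zero    = refl
sumℤ-map-upTo f (suc n) = begin
  sumℤ (map f (upTo (suc n)))              ≡⟨ cong (λ l → sumℤ (map f l)) (List.upTo-∷ʳ n) ⟨
  sumℤ (map f (upTo n ++ [ n ]))           ≡⟨ cong sumℤ (List.map-++ f (upTo n) [ n ]) ⟩
  sumℤ (map f (upTo n) ++ [ f n ])         ≡⟨ sumℤ-++ (map f (upTo n)) [ f n ] ⟩
  sumℤ (map f (upTo n)) + (f n + 0ℤ)       ≡⟨ cong₂ _+_ (sumℤ-map-upTo f n) (ℤ.+-identityʳ (f n)) ⟩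
  Σ< n f + f n                             ∎
  where open ≡-Reasoning

module OddModulus (t : ℕ) (t-odd : t ℕ.% 2 ≡ 1) where

  t≡1+[t/2]*2 : t ≡ suc (t ℕ./ 2 ℕ.* 2)
  t≡1+[t/2]*2 = trans (ℕ.m≡m%n+[m/n]*n t 2) (cong (λ r → r ℕ.+ t ℕ./ 2 ℕ.* 2) t-odd)

  sgn-t≡-1 : sgn (+ t) ≡ -1ℤ
  sgn-t≡-1 = trans (sgn≡sgn₂ (+ t)) (cong sgn₂ t-odd)

  sgn-*t : ∀ z → sgn (z * + t) ≡ sgn z
  sgn-*t z = begin
    sgn (z * + t)                  ≡⟨ cong sgn z*t≡ ⟩
    sgn (z + w + w)                ≡⟨ trans (sgn-+ (z + w) w) (cong (λ e → e * sgn w) (sgn-+ z w)) ⟩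
    sgn z * sgn w * sgn w          ≡⟨ ℤ.*-assoc (sgn z) (sgn w) (sgn w) ⟩
    sgn z * (sgn w * sgn w)        ≡⟨ cong (λ e → sgn z * e) (sgn-square w) ⟩
    sgn z * 1ℤ                     ≡⟨ ℤ.*-identityʳ (sgn z) ⟩
    sgn z                          ∎
    where
    open ≡-Reasoning
    k = t ℕ./ 2
    w = z * + k
    expand : ∀ z k → z * (1ℤ + k * + 2) ≡ z + z * k + z * k
    expand = solve-∀
    z*t≡ : z * + t ≡ z + w + w
    z*t≡ = trans (cong (λ n → z * + n) t≡1+[t/2]*2)
                 (trans (cong (λ e → z * (1ℤ + e)) (ℤ.pos-* k 2)) (expand z (+ k)))

  sgn-+t : ∀ z → sgn (z + + t) ≡ - sgn z
  sgn-+t z = begin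
    sgn (z + + t)       ≡⟨ sgn-+ z (+ t) ⟩
    sgn z * sgn (+ t)   ≡⟨ cong (λ e → sgn z * e) sgn-t≡-1 ⟩
    sgn z * -1ℤ         ≡⟨ ℤ.*-comm (sgn z) -1ℤ ⟩
    -1ℤ * sgn z         ≡⟨ ℤ.-1*i≡-i (sgn z) ⟩
    - sgn z             ∎
    where open ≡-Reasoning

  ∑-sgn-alternating : ∑[ j < t ] sgn (+ j) ≡ 1ℤ
  ∑-sgn-alternating = subst (λ n → ∑[ j < n ] sgn (+ j) ≡ 1ℤ) (sym t≡1+[t/2]*2) (alternating (t ℕ./ 2))
    where
    cancel : ∀ s u → s + u + - u ≡ s
    cancel = solve-∀
    alternating : ∀ k → ∑[ j < suc (k ℕ.* 2) ] sgn (+ j) ≡ 1ℤ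
    alternating zero    = refl
    alternating (suc k) = begin
      ∑[ j < suc (k ℕ.* 2) ] sgn (+ j) + sgn (+ suc (k ℕ.* 2)) + sgn (+ suc (suc (k ℕ.* 2)))
        ≡⟨ cong (λ e → ∑[ j < suc (k ℕ.* 2) ] sgn (+ j) + sgn (+ suc (k ℕ.* 2)) + e) (sgn-suc (suc (k ℕ.* 2))) ⟩
      ∑[ j < suc (k ℕ.* 2) ] sgn (+ j) + sgn (+ suc (k ℕ.* 2)) + - sgn (+ suc (k ℕ.* 2))
        ≡⟨ cancel _ _ ⟩
      ∑[ j < suc (k ℕ.* 2) ] sgn (+ j)
        ≡⟨ alternating k ⟩
      1ℤ ∎
      where open ≡-Reasoning

-- The β-numbers λ_j − j of the rows xs, numbered from j = m + 1 (with λ_j = 0 past the end).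
bead : ℕ → List ℕ → ℕ → ℤ
bead m xs k = + part xs k - + suc m - + k

IsBead : ℕ → List ℕ → ℤ → Set
IsBead m xs y = ∃[ k ] y ≡ bead m xs k

IsBead-∷ : ∀ {m x xs y} → IsBead m (x ∷ xs) y ⇔ (y ≡ + x - + suc m ⊎ IsBead (suc m) xs y)
IsBead-∷ {m} {x} {xs} {y} = mk⇔ split join
  where
  first : + x - + suc m - + 0 ≡ + x - + suc m
  first = ℤ.+-identityʳ (+ x - + suc m)
  shift : ∀ p m k → p - (1ℤ + m) - (1ℤ + k) ≡ p - (1ℤ + (1ℤ + m)) - k
  shift = solve-∀
  split : IsBead m (x ∷ xs) y → y ≡ + x - + suc m ⊎ IsBead (suc m) xs y
  split (zero  , y≡) = inj₁ (trans y≡ first)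
  split (suc k , y≡) = inj₂ (k , trans y≡ (shift (+ part xs k) (+ m) (+ k)))
  join : y ≡ + x - + suc m ⊎ IsBead (suc m) xs y → IsBead m (x ∷ xs) y
  join (inj₁ y≡)       = zero , trans y≡ (sym first)
  join (inj₂ (k , y≡)) = suc k , trans y≡ (sym (shift (+ part xs k) (+ m) (+ k)))

bgAux-1≡-bgAux-0 : ∀ xs → bgAux 1 xs ≡ - bgAux 0 xs
bgAux-1≡-bgAux-0 []       = refl
bgAux-1≡-bgAux-0 (x ∷ xs) = begin
  - + (x ℕ.% 2) + bgAux 0 xs            ≡⟨ negate (+ (x ℕ.% 2)) (bgAux 0 xs) ⟩
  - (+ (x ℕ.% 2) + - bgAux 0 xs)        ≡⟨ cong (λ e → - (+ (x ℕ.% 2) + e)) (bgAux-1≡-bgAux-0 xs) ⟨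
  - (+ (x ℕ.% 2) + bgAux 1 xs)          ∎
  where
  open ≡-Reasoning
  negate : ∀ p b → - p + b ≡ - (p + - b)
  negate = solve-∀

countDiff : {A : Set} → (A → ℕ) → ℕ → ℕ → List A → ℤ
countDiff f i j cs = + count f i cs - + count f j cs

countDiff-++ : ∀ {A : Set} (f : A → ℕ) i j cs ds →
               countDiff f i j (cs ++ ds) ≡ countDiff f i j cs + countDiff f i j ds
countDiff-++ f i j cs ds = begin
  + count f i (cs ++ ds) - + count f j (cs ++ ds)
    ≡⟨ cong₂ (λ a b → + a - + b) (count-++ i) (count-++ j) ⟩
  + (count f i cs ℕ.+ count f i ds) - + (count f j cs ℕ.+ count f j ds)
    ≡⟨ cong₂ _-_ (ℤ.pos-+ (count f i cs) _) (ℤ.pos-+ (count f j cs) _) ⟩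
  (+ count f i cs + + count f i ds) - (+ count f j cs + + count f j ds)
    ≡⟨ regroup (+ count f i cs) (+ count f i ds) (+ count f j cs) (+ count f j ds) ⟩
  countDiff f i j cs + countDiff f i j ds ∎
  where
  open ≡-Reasoning
  count-++ : ∀ k → count f k (cs ++ ds) ≡ count f k cs ℕ.+ count f k ds
  count-++ k = go cs
    where
    go : ∀ cs → count f k (cs ++ ds) ≡ count f k cs ℕ.+ count f k ds
    go []       = refl
    go (c ∷ cs) with f c ℕ.≟ k
    ... | yes _ = cong suc (go cs)
    ... | no  _ = go cs
  regroup : ∀ a b c d → (a + b) - (c + d) ≡ (a - c) + (b - d)
  regroup = solve-∀

countDiff-[] : ∀ {A : Set} (f : A → ℕ) i j c → countDiff f i j [ c ] ≡ δ (f c) i - δ (f c) j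
countDiff-[] f i j c = cong₂ _-_ (single i) (single j)
  where
  single : ∀ k → + count f k [ c ] ≡ δ (f c) k
  single k with f c ℕ.≟ k
  ... | yes _ = refl
  ... | no  _ = refl

rowCells-suc : ∀ a n → rowCells a (suc n) ≡ rowCells a n ++ [ (a , suc n) ]
rowCells-suc a n = trans (cong (map cell) (sym (List.upTo-∷ʳ n))) (List.map-++ cell (upTo n) [ n ])
  where
  cell : ℕ → ℕ × ℕ
  cell j = a , suc j

module Abacus (t : ℕ) .{{_ : NonZero t}} where

  -- The lowest position ≥ −m on runner i: the lowest gap on runner i for the empty
  -- partition whose rows are numbered from m + 1.
  base : ℕ → ℕ → ℤ
  base m i = + ((i ℕ.+ m) ℕ.% t) - + m

  base-res : ∀ {i} m → i ℕ.< t → base m i %ℕ t ≡ i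
  base-res {i} m i<t = begin
    base m i %ℕ t                  ≡⟨ cong (_%ℕ t) base≡ ⟩
    (+ i + (- + q) * + t) %ℕ t      ≡⟨ [i+k*d]%ℕd≡i%ℕd (+ i) (- + q) ⟩
    i ℕ.% t                        ≡⟨ ℕ.m<n⇒m%n≡m i<t ⟩
    i                              ∎
    where
    open ≡-Reasoning
    rem = (i ℕ.+ m) ℕ.% t
    q = (i ℕ.+ m) ℕ./ t
    division : + rem + + q * + t ≡ + i + + m
    division = begin
      + rem + + q * + t     ≡⟨ cong (λ e → + rem + e) (ℤ.pos-* q t) ⟨
      + rem + + (q ℕ.* t)   ≡⟨ ℤ.pos-+ rem (q ℕ.* t) ⟨
      + (rem ℕ.+ q ℕ.* t)   ≡⟨ cong +_ (ℕ.m≡m%n+[m/n]*n (i ℕ.+ m) t) ⟨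
      + (i ℕ.+ m)         ≡⟨ ℤ.pos-+ i m ⟩
      + i + + m           ∎
    regroup : ∀ r q t m → r - m ≡ (r + q * t) - m - q * t
    regroup = solve-∀
    regroup′ : ∀ i m q t → i + m - m - q * t ≡ i + (- q) * t
    regroup′ = solve-∀
    base≡ : base m i ≡ + i + (- + q) * + t
    base≡ = begin
      + rem - + m                     ≡⟨ regroup (+ rem) (+ q) (+ t) (+ m) ⟩
      (+ rem + + q * + t) - + m - + q * + t ≡⟨ cong (λ e → e - + m - + q * + t) division ⟩
      + i + + m - + m - + q * + t     ≡⟨ regroup′ (+ i) (+ m) (+ q) (+ t) ⟩
      + i + (- + q) * + t             ∎

  base-lower : ∀ m i → - + m ≤ base m i
  base-lower m i = subst (- + m ≤_) (ℤ.+-comm (- + m) _) (ℤ.i≤i+j (- + m) (+ ((i ℕ.+ m) ℕ.% t)))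

  base-upper : ∀ m i → base m i < - + m + + t
  base-upper m i = subst (_< - + m + + t) (ℤ.+-comm (- + m) _)
                         (ℤ.+-monoʳ-< (- + m) (ℤ.+<+ (ℕ.m%n<n (i ℕ.+ m) t)))

  base-unique : ∀ {m i y} → i ℕ.< t → y %ℕ t ≡ i → - + m ≤ y → y < - + m + + t → y ≡ base m i
  base-unique {m} {i} {y} i<t y-res -m≤y y<-m+t with ℤ.≤-total (base m i) y
  ... | inj₁ base≤y = %ℕ-injective-window (trans y-res (sym (base-res m i<t))) base≤y
                        (ℤ.<-≤-trans y<-m+t (ℤ.+-monoˡ-≤ (+ t) (base-lower m i)))
  ... | inj₂ y≤base = sym (%ℕ-injective-window (trans (base-res m i<t) (sym y-res)) y≤base
                        (ℤ.<-≤-trans (base-upper m i) (ℤ.+-monoˡ-≤ (+ t) -m≤y)))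

  base-least : ∀ {m y} → - + m ≤ y → base m (y %ℕ t) ≤ y
  base-least {m} {y} -m≤y = ℤ.≮⇒≥ λ y<base →
    ℤ.<-irrefl (base-unique (n%ℕd<d y t) refl -m≤y (ℤ.<-trans y<base (base-upper m _))) y<base

  base-zero : ∀ {i} → i ℕ.< t → base 0 i ≡ + i
  base-zero {i} i<t = trans (ℤ.+-identityʳ _) (cong +_ (trans (cong (ℕ._% t) (ℕ.+-identityʳ i)) (ℕ.m<n⇒m%n≡m i<t)))

  i<i+t : ∀ z → z < z + + t
  i<i+t z = subst (λ n → z < z + + n) (ℕ.suc-pred t) (i<i+[1+n] z (ℕ.pred t))

  -suc<- : ∀ m → - + suc m < - + m
  -suc<- m = ℤ.neg-mono-< (ℤ.+<+ (ℕ.n<1+n m))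

  base-boundary : ∀ m → base (suc m) ((- + suc m) %ℕ t) ≡ - + suc m
  base-boundary m = sym (base-unique (n%ℕd<d (- + suc m) t) refl ℤ.≤-refl (i<i+t (- + suc m)))

  base-step : ∀ m {i} → i ℕ.< t → base m i ≡ base (suc m) i + δ ((- + suc m) %ℕ t) i * + t
  base-step m {i} i<t = by-cases (τ ℕ.≟ i)
    where
    open ≡-Reasoning
    τ = (- + suc m) %ℕ t

    at-boundary : τ ≡ i → base m i ≡ - + suc m + + t
    at-boundary τ≡i = sym (base-unique i<t res -m≤ <-m+t)
      where
      res : (- + suc m + + t) %ℕ t ≡ i
      res = trans (cong (λ e → (- + suc m + e) %ℕ t) (sym (ℤ.*-identityˡ (+ t))))
                  (trans ([i+k*d]%ℕd≡i%ℕd (- + suc m) 1ℤ) τ≡i)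
      shift : ∀ m → - (1ℤ + m) + (1ℤ + 0ℤ) ≡ - m
      shift = solve-∀
      -m≤ : - + m ≤ - + suc m + + t
      -m≤ = ℤ.≤-trans (ℤ.≤-reflexive (sym (shift (+ m))))
                      (ℤ.+-monoʳ-≤ (- + suc m) (ℤ.i<j⇒suc[i]≤j (ℤ.+<+ (ℕ.>-nonZero⁻¹ t))))
      <-m+t : - + suc m + + t < - + m + + t
      <-m+t = ℤ.+-monoˡ-< (+ t) (-suc<- m)

    off-boundary : τ ≢ i → base m i ≡ base (suc m) i
    off-boundary τ≢i = sym (base-unique i<t (base-res (suc m) i<t) -m≤ <-m+t)
      where
      boundary≢ : - + suc m ≢ base (suc m) i
      boundary≢ eq = τ≢i (trans (cong (_%ℕ t) eq) (base-res (suc m) i<t))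
      shift : ∀ m → 1ℤ + - (1ℤ + m) ≡ - m
      shift = solve-∀
      -m≤ : - + m ≤ base (suc m) i
      -m≤ = subst (_≤ base (suc m) i) (shift (+ m))
                  (ℤ.i<j⇒suc[i]≤j (ℤ.≤∧≢⇒< (base-lower (suc m) i) boundary≢))
      <-m+t : base (suc m) i < - + m + + t
      <-m+t = ℤ.<-trans (base-upper (suc m) i) (ℤ.+-monoˡ-< (+ t) (-suc<- m))

    by-cases : Dec (τ ≡ i) → base m i ≡ base (suc m) i + δ τ i * + t
    by-cases (yes τ≡i) = begin
      base m i                        ≡⟨ at-boundary τ≡i ⟩
      - + suc m + + t                 ≡⟨ cong (λ e → - + suc m + e) (ℤ.*-identityˡ (+ t)) ⟨
      - + suc m + 1ℤ * + t            ≡⟨ cong₂ (λ b d → b + d * + t) boundary (sym δτi≡1) ⟩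
      base (suc m) i + δ τ i * + t    ∎
      where
      boundary : - + suc m ≡ base (suc m) i
      boundary = trans (sym (base-boundary m)) (cong (base (suc m)) τ≡i)
      δτi≡1 : δ τ i ≡ 1ℤ
      δτi≡1 = trans (cong (λ j → δ j i) τ≡i) (δ-refl i)
    by-cases (no τ≢i) = begin
      base m i                        ≡⟨ off-boundary τ≢i ⟩
      base (suc m) i                  ≡⟨ ℤ.+-identityʳ (base (suc m) i) ⟨
      base (suc m) i + 0ℤ             ≡⟨ cong (λ d → base (suc m) i + d * + t) (δ-≢ τ≢i) ⟨
      base (suc m) i + δ τ i * + t    ∎

  -- nVector 0 (parts π) is the paper's n-vector (nDiff≡nVector): the residues along
  -- row j are consecutive, so row j contributes δ(λ_j − j) − δ(−j) to n_i.
  nVector : ℕ → List ℕ → ℕ → ℤ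
  nVector m []       i = 0ℤ
  nVector m (x ∷ xs) i = δ ((+ x - + suc m) %ℕ t) i - δ ((- + suc m) %ℕ t) i + nVector (suc m) xs i

  level : ℕ → List ℕ → ℕ → ℤ
  level m xs i = base m i + nVector m xs i * + t

  level-res : ∀ m xs {i} → i ℕ.< t → level m xs i %ℕ t ≡ i
  level-res m xs i<t = trans ([i+k*d]%ℕd≡i%ℕd (base m _) (nVector m xs _)) (base-res m i<t)

  level-∷ : ∀ m x xs {i} → i ℕ.< t →
            level m (x ∷ xs) i ≡ level (suc m) xs i + δ ((+ x - + suc m) %ℕ t) i * + t
  level-∷ m x xs {i} i<t = begin
    base m i + (dρ - dτ + n) * + t                 ≡⟨ cong (λ b → b + (dρ - dτ + n) * + t) (base-step m i<t) ⟩
    base (suc m) i + dτ * + t + (dρ - dτ + n) * + t ≡⟨ regroup (base (suc m) i) dρ dτ n (+ t) ⟩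
    base (suc m) i + n * + t + dρ * + t            ∎
    where
    open ≡-Reasoning
    dρ = δ ((+ x - + suc m) %ℕ t) i
    dτ = δ ((- + suc m) %ℕ t) i
    n  = nVector (suc m) xs i
    regroup : ∀ b dρ dτ n t → b + dτ * t + (dρ - dτ + n) * t ≡ b + n * t + dρ * t
    regroup = solve-∀

  -- `r` counts cells through a pattern lambda of Defs that cannot be named here,
  -- so the counting function is abstracted to anything satisfying its defining equation.
  module _ {f : ℕ × ℕ → ℕ} (f≡residue : ∀ a b → f (a , b) ≡ residue t a b) {i} (i<t : i ℕ.< t) where

    row-countDiff : ∀ a n → countDiff f i (next t i) (rowCells a n)
                              ≡ δ ((+ n - + a) %ℕ t) i - δ ((+ 0 - + a) %ℕ t) i
    row-countDiff a zero    = sym (ℤ.+-inverseʳ (δ ((+ 0 - + a) %ℕ t) i))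
    row-countDiff a (suc n) = begin
      countDiff f i i⁺ (rowCells a (suc n))
        ≡⟨ cong (countDiff f i i⁺) (rowCells-suc a n) ⟩
      countDiff f i i⁺ (rowCells a n ++ [ (a , suc n) ])
        ≡⟨ countDiff-++ f i i⁺ (rowCells a n) [ (a , suc n) ] ⟩
      countDiff f i i⁺ (rowCells a n) + countDiff f i i⁺ [ (a , suc n) ]
        ≡⟨ cong₂ _+_ (row-countDiff a n) (countDiff-[] f i i⁺ (a , suc n)) ⟩
      (δ u i - δ u₀ i) + (δ (f (a , suc n)) i - δ (f (a , suc n)) i⁺)
        ≡⟨ cong (λ v → (δ u i - δ u₀ i) + (δ v i - δ v i⁺)) (f≡residue a (suc n)) ⟩
      (δ u i - δ u₀ i) + (δ u⁺ i - δ u⁺ i⁺)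
        ≡⟨ cong (λ v → (δ u i - δ u₀ i) + (δ u⁺ i - δ v i⁺)) u⁺≡next ⟩
      (δ u i - δ u₀ i) + (δ u⁺ i - δ (next t u) i⁺)
        ≡⟨ cong (λ v → (δ u i - δ u₀ i) + (δ u⁺ i - v)) (δ-next (n%ℕd<d (+ n - + a) t) i<t) ⟩
      (δ u i - δ u₀ i) + (δ u⁺ i - δ u i)
        ≡⟨ telescope (δ u i) (δ u₀ i) (δ u⁺ i) ⟩
      δ u⁺ i - δ u₀ i ∎
      where
      open ≡-Reasoning
      i⁺ = next t i
      u  = (+ n - + a) %ℕ t
      u₀ = (+ 0 - + a) %ℕ t
      u⁺ = (+ suc n - + a) %ℕ t
      shift : ∀ n a → (1ℤ + n) - a ≡ n - a + 1ℤ
      shift = solve-∀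
      u⁺≡next : u⁺ ≡ next t u
      u⁺≡next = trans (cong (_%ℕ t) (shift (+ n) (+ a))) (%ℕ-suc (+ n - + a))
      telescope : ∀ a b c → (a - b) + (c - a) ≡ c - b
      telescope = solve-∀

    cells-countDiff : ∀ m xs → countDiff f i (next t i) (allCells (suc m) xs) ≡ nVector m xs i
    cells-countDiff m []       = refl
    cells-countDiff m (x ∷ xs) =
      trans (countDiff-++ f i (next t i) (rowCells (suc m) x) (allCells (suc (suc m)) xs))
            (cong₂ _+_ (row-countDiff (suc m) x) (cells-countDiff (suc m) xs))

  nDiff≡nVector : ∀ π {i} → i ℕ.< t → nDiff t π i ≡ nVector 0 (parts π) i
  nDiff≡nVector π {i} i<t = trans nDiff-next (cells-countDiff (λ _ _ → refl) i<t 0 (parts π))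
    where
    nDiff-next : nDiff t π i ≡ + r t π i - + r t π (next t i)
    nDiff-next with suc i ℕ.<? t
    ... | yes _ = refl
    ... | no  _ = refl

  -- Runner i consists of the positions ≡ i (mod t); B fills it exactly below L i.
  FilledBelow : (ℤ → Set) → (ℕ → ℤ) → Set
  FilledBelow B L = ∀ y → B y ⇔ y < L (y %ℕ t)

  FilledBelow-resp : ∀ {B B′ L L′} → (∀ y → B y ⇔ B′ y) → (∀ i → i ℕ.< t → L i ≡ L′ i) →
                     FilledBelow B L → FilledBelow B′ L′
  FilledBelow-resp {L = L} {L′} B⇔B′ L≗L′ filled y =
    ⇔.trans (⇔.sym (B⇔B′ y)) (⇔.trans (filled y) (mk⇔ (subst (y <_) L≡L′) (subst (y <_) (sym L≡L′))))
    where
    L≡L′ : L (y %ℕ t) ≡ L′ (y %ℕ t)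
    L≡L′ = L≗L′ (y %ℕ t) (n%ℕd<d y t)

  FilledBelow-level : ∀ {B L X} → FilledBelow B L → (∀ i → i ℕ.< t → L i %ℕ t ≡ i) →
                      ¬ B X → B (X - + t) → X ≡ L (X %ℕ t)
  FilledBelow-level {B} {L} {X} filled L-res ¬BX BX-t = %ℕ-injective-window same-runner L≤X X<L+t
    where
    ρ = X %ℕ t
    same-runner : X %ℕ t ≡ L ρ %ℕ t
    same-runner = sym (L-res ρ (n%ℕd<d X t))
    L≤X : L ρ ≤ X
    L≤X = ℤ.≮⇒≥ (λ X<L → ¬BX (from (filled X) X<L))
    runner-below : (X - + t) %ℕ t ≡ ρ
    runner-below = trans (cong (λ e → (X + e) %ℕ t) (sym (ℤ.-1*i≡-i (+ t)))) ([i+k*d]%ℕd≡i%ℕd X -1ℤ)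
    X-t<L : X - + t < L ρ
    X-t<L = subst (λ i → X - + t < L i) runner-below (to (filled (X - + t)) BX-t)
    cancel : ∀ x t → x - t + t ≡ x
    cancel = solve-∀
    X<L+t : X < L ρ + + t
    X<L+t = subst (_< L ρ + + t) (cancel X (+ t)) (ℤ.+-monoˡ-< (+ t) X-t<L)

  FilledBelow-insert : ∀ {B L X} → FilledBelow B L → X ≡ L (X %ℕ t) →
                       FilledBelow (λ y → y ≡ X ⊎ B y) (λ i → L i + δ (X %ℕ t) i * + t)
  FilledBelow-insert {B} {L} {X} filled X≡L y = mk⇔ push pull
    where
    ρ = X %ℕ t

    L′ : ℕ → ℤ
    L′ i = L i + δ ρ i * + t

    L′-ρ : L′ ρ ≡ X + + t
    L′-ρ = cong₂ _+_ (sym X≡L) (trans (cong (_* + t) (δ-refl ρ)) (ℤ.*-identityˡ (+ t)))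

    L′-other : ∀ {i} → i ≢ ρ → L′ i ≡ L i
    L′-other {i} i≢ρ = trans (cong (λ d → L i + d * + t) (δ-≢ (λ ρ≡i → i≢ρ (sym ρ≡i)))) (ℤ.+-identityʳ (L i))

    L≤L′ : ∀ i → L i ≤ L′ i
    L≤L′ i with i ℕ.≟ ρ
    ... | yes refl = subst₂ _≤_ X≡L (sym L′-ρ) (ℤ.<⇒≤ (i<i+t X))
    ... | no  i≢ρ  = ℤ.≤-reflexive (sym (L′-other i≢ρ))

    push : y ≡ X ⊎ B y → y < L′ (y %ℕ t)
    push (inj₁ refl) = subst (X <_) (sym L′-ρ) (i<i+t X)
    push (inj₂ By)   = ℤ.<-≤-trans (to (filled y) By) (L≤L′ (y %ℕ t))

    pull : y < L′ (y %ℕ t) → y ≡ X ⊎ B y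
    pull y<L′ with y %ℕ t ℕ.≟ ρ
    ... | no  res≢ρ = inj₂ (from (filled y) (subst (y <_) (L′-other res≢ρ) y<L′))
    ... | yes res≡ρ with ℤ.<-cmp y X
    ...   | tri< y<X _ _ = inj₂ (from (filled y) (subst (y <_) (trans X≡L (cong L (sym res≡ρ))) y<X))
    ...   | tri≈ _ y≡X _ = inj₁ y≡X
    ...   | tri> _ _ X<y = ⊥-elim (ℤ.<-irrefl (sym y≡X) X<y)
      where
      y≡X : y ≡ X
      y≡X = %ℕ-injective-window res≡ρ (ℤ.<⇒≤ X<y) (subst (y <_) (trans (cong L′ res≡ρ) L′-ρ) y<L′)

  FilledBelow-empty : ∀ m → FilledBelow (IsBead m []) (base m)
  FilledBelow-empty m y = mk⇔ below-base is-bead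
    where
    unwind : ∀ m k → 0ℤ - (1ℤ + m) - k + (1ℤ + k) ≡ - m
    unwind = solve-∀
    below-base : IsBead m [] y → y < base m (y %ℕ t)
    below-base (k , refl) =
      ℤ.<-≤-trans (subst (bead m [] k <_) (unwind (+ m) (+ k)) (i<i+[1+n] (bead m [] k) k))
                  (base-lower m (bead m [] k %ℕ t))
    below-runner : y < base m (y %ℕ t) → y < - + m
    below-runner y<base = ℤ.≰⇒> (λ -m≤y → ℤ.<⇒≱ y<base (base-least -m≤y))
    rewind : ∀ y n → y ≡ 0ℤ - (1ℤ + - (1ℤ + y + n)) - n
    rewind = solve-∀
    is-bead : y < base m (y %ℕ t) → IsBead m [] y
    is-bead y<base with i≤j⇒∃[n]j≡i+n (ℤ.i<j⇒suc[i]≤j (below-runner y<base))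
    ... | n , -m≡ = n , (begin
      y                                  ≡⟨ rewind y (+ n) ⟩
      0ℤ - (1ℤ + - (1ℤ + y + + n)) - + n  ≡⟨ cong (λ e → 0ℤ - (1ℤ + - e) - + n) -m≡ ⟨
      0ℤ - (1ℤ + - - + m) - + n          ≡⟨ cong (λ e → 0ℤ - (1ℤ + e) - + n) (ℤ.neg-involutive (+ m)) ⟩
      0ℤ - (1ℤ + + m) - + n              ∎)
      where open ≡-Reasoning

  first-bead-at-level : ∀ {m x xs L} → FilledBelow (IsBead (suc m) xs) L →
                        (∀ i → i ℕ.< t → L i %ℕ t ≡ i) →
                        Linked (λ a b → b ℕ.≤ a) (x ∷ xs) → ¬ RimHookSpan (x ∷ xs) t →
                        + x - + suc m ≡ L ((+ x - + suc m) %ℕ t)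
  first-bead-at-level {m} {x} {xs} {L} filled L-res linked no-span =
    FilledBelow-level {IsBead (suc m) xs} {L} filled L-res not-bead bead-below
    where
    open ≡-Reasoning
    X = + x - + suc m

    not-bead : ¬ IsBead (suc m) xs X
    not-bead (k , X≡bead) with ℕ.m≤n⇒∃[o]m+o≡n (decreasing-≤ (part-decreasing linked) {0} {suc k} z≤n)
    ... | n , p+n≡x =
      ℤ.<-irrefl (sym X≡bead) (subst (bead (suc m) xs k <_) bead+gap≡X (i<i+[1+n] _ (n ℕ.+ k)))
      where
      p = part xs k
      regroup : ∀ p n m k → p - (1ℤ + (1ℤ + m)) - k + (1ℤ + (n + k)) ≡ p + n - (1ℤ + m)
      regroup = solve-∀
      bead+gap≡X : bead (suc m) xs k + + suc (n ℕ.+ k) ≡ X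
      bead+gap≡X = begin
        bead (suc m) xs k + (1ℤ + + (n ℕ.+ k))
          ≡⟨ cong (λ e → bead (suc m) xs k + (1ℤ + e)) (ℤ.pos-+ n k) ⟩
        bead (suc m) xs k + (1ℤ + (+ n + + k))
          ≡⟨ regroup (+ p) (+ n) (+ m) (+ k) ⟩
        + p + + n - + suc m
          ≡⟨ cong (λ e → e - + suc m) (trans (sym (ℤ.pos-+ p n)) (cong +_ p+n≡x)) ⟩
        X                                              ∎

    bead-below : IsBead (suc m) xs (X - + t)
    bead-below with ¬RimHookSpan⇒bead-below (ℕ.>-nonZero⁻¹ t) linked no-span
    ... | k , p+t≡x+1+k = k , (begin
      + x - + suc m - + t
        ≡⟨ regroup (+ x) (+ m) (+ t) (+ k) ⟩
      + x + (1ℤ + + k) - + t - (1ℤ + (1ℤ + + m)) - + k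
        ≡⟨ cong (λ e → e - + t - (1ℤ + (1ℤ + + m)) - + k) cast ⟨
      + p + + t - + t - (1ℤ + (1ℤ + + m)) - + k
        ≡⟨ regroup′ (+ p) (+ t) (+ m) (+ k) ⟩
      bead (suc m) xs k                                      ∎)
      where
      p = part xs k
      cast : + p + + t ≡ + x + (1ℤ + + k)
      cast = trans (sym (ℤ.pos-+ p t)) (trans (cong +_ p+t≡x+1+k) (ℤ.pos-+ x (suc k)))
      regroup : ∀ x m t k → x - (1ℤ + m) - t ≡ x + (1ℤ + k) - t - (1ℤ + (1ℤ + m)) - k
      regroup = solve-∀
      regroup′ : ∀ p t m k → p + t - t - (1ℤ + (1ℤ + m)) - k ≡ p - (1ℤ + (1ℤ + m)) - k
      regroup′ = solve-∀

  core⇒FilledBelow-level : ∀ m {xs} → Linked (λ a b → b ℕ.≤ a) xs → ¬ RimHookSpan xs t →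
                           FilledBelow (IsBead m xs) (level m xs)
  core⇒FilledBelow-level m {[]}     _      _       =
    FilledBelow-resp {L = base m} (λ _ → ⇔.refl) (λ i _ → sym (ℤ.+-identityʳ (base m i))) (FilledBelow-empty m)
  core⇒FilledBelow-level m {x ∷ xs} linked no-span =
    FilledBelow-resp {L = λ i → level (suc m) xs i + δ ((+ x - + suc m) %ℕ t) i * + t}
      (λ _ → ⇔.sym IsBead-∷) (λ i i<t → sym (level-∷ m x xs i<t))
      (FilledBelow-insert {IsBead (suc m) xs} {level (suc m) xs} tail top)
    where
    tail : FilledBelow (IsBead (suc m) xs) (level (suc m) xs)
    tail = core⇒FilledBelow-level (suc m) (Linked.tail linked) (¬RimHookSpan-∷ no-span)
    top : + x - + suc m ≡ level (suc m) xs ((+ x - + suc m) %ℕ t)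
    top = first-bead-at-level {L = level (suc m) xs} tail (λ i → level-res (suc m) xs) linked no-span

  module Signs (t-odd : t ℕ.% 2 ≡ 1) where
    open OddModulus t t-odd

    ∑-sgn-flip : ∀ (L : ℕ → ℤ) {ρ} → ρ ℕ.< t →
                 ∑[ i < t ] sgn (L i + δ ρ i * + t) ≡ ∑[ i < t ] sgn (L i) - + 2 * sgn (L ρ)
    ∑-sgn-flip L {ρ} ρ<t = begin
      ∑[ i < t ] shifted i
        ≡⟨ ∑-update (sgn ∘ L) shifted ρ<t unchanged ⟩
      ∑[ i < t ] sgn (L i) + (shifted ρ - sgn (L ρ))
        ≡⟨ cong (λ e → ∑[ i < t ] sgn (L i) + (e - sgn (L ρ))) flipped ⟩
      ∑[ i < t ] sgn (L i) + (- sgn (L ρ) - sgn (L ρ))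
        ≡⟨ double (∑[ i < t ] sgn (L i)) (sgn (L ρ)) ⟩
      ∑[ i < t ] sgn (L i) - + 2 * sgn (L ρ)          ∎
      where
      open ≡-Reasoning
      shifted : ℕ → ℤ
      shifted i = sgn (L i + δ ρ i * + t)
      unchanged : ∀ i → i ≢ ρ → shifted i ≡ sgn (L i)
      unchanged i i≢ρ = cong sgn (trans (cong (λ d → L i + d * + t) (δ-≢ (λ ρ≡i → i≢ρ (sym ρ≡i))))
                                        (ℤ.+-identityʳ (L i)))
      flipped : shifted ρ ≡ - sgn (L ρ)
      flipped = trans (cong (λ d → sgn (L ρ + d)) (trans (cong (_* + t) (δ-refl ρ)) (ℤ.*-identityˡ (+ t))))
                      (sgn-+t (L ρ))
      double : ∀ s u → s + (- u - u) ≡ s - + 2 * u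
      double = solve-∀

    ∑-sgn-base : ∀ m → ∑[ i < t ] sgn (base m i) ≡ sgn (+ m)
    ∑-sgn-base zero    = trans (∑-cong t (λ i i<t → cong sgn (base-zero i<t))) ∑-sgn-alternating
    ∑-sgn-base (suc m) = begin
      ∑[ i < t ] sgn (base (suc m) i)                         ≡⟨ add-back _ s ⟩
      ∑[ i < t ] sgn (base (suc m) i) - + 2 * s + + 2 * s      ≡⟨ cong (λ e → e + + 2 * s) previous ⟨
      ∑[ i < t ] sgn (base m i) + + 2 * s                      ≡⟨ cong (λ e → e + + 2 * s) (∑-sgn-base m) ⟩
      sgn (+ m) + + 2 * s                                      ≡⟨ cong (λ e → e + + 2 * s) sgn-m ⟩
      - s + + 2 * s                                            ≡⟨ collect s ⟩
      s                                                        ∎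
      where
      open ≡-Reasoning
      s = sgn (+ suc m)
      τ = (- + suc m) %ℕ t
      previous : ∑[ i < t ] sgn (base m i) ≡ ∑[ i < t ] sgn (base (suc m) i) - + 2 * s
      previous = begin
        ∑[ i < t ] sgn (base m i)
          ≡⟨ ∑-cong t (λ i i<t → cong sgn (base-step m i<t)) ⟩
        ∑[ i < t ] sgn (base (suc m) i + δ τ i * + t)
          ≡⟨ ∑-sgn-flip (base (suc m)) (n%ℕd<d (- + suc m) t) ⟩
        ∑[ i < t ] sgn (base (suc m) i) - + 2 * sgn (base (suc m) τ)
          ≡⟨ cong (λ e → ∑[ i < t ] sgn (base (suc m) i) - + 2 * sgn e) (base-boundary m) ⟩
        ∑[ i < t ] sgn (base (suc m) i) - + 2 * sgn (- + suc m)
          ≡⟨ cong (λ e → ∑[ i < t ] sgn (base (suc m) i) - + 2 * e) (sgn-neg (+ suc m)) ⟩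
        ∑[ i < t ] sgn (base (suc m) i) - + 2 * s                     ∎
      sgn-m : sgn (+ m) ≡ - s
      sgn-m = trans (sym (ℤ.neg-involutive (sgn (+ m)))) (cong -_ (sym (sgn-suc m)))
      add-back : ∀ a s → a ≡ a - + 2 * s + + 2 * s
      add-back = solve-∀
      collect : ∀ s → - s + + 2 * s ≡ s
      collect = solve-∀

    sgn-level-zero : ∀ xs {j} → j ℕ.< t → sgn (level 0 xs j) ≡ sgn (+ j + nVector 0 xs j)
    sgn-level-zero xs {j} j<t = begin
      sgn (base 0 j + n * + t)    ≡⟨ cong (λ b → sgn (b + n * + t)) (base-zero j<t) ⟩
      sgn (+ j + n * + t)         ≡⟨ sgn-+ (+ j) (n * + t) ⟩
      sgn (+ j) * sgn (n * + t)   ≡⟨ cong (λ e → sgn (+ j) * e) (sgn-*t n) ⟩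
      sgn (+ j) * sgn n           ≡⟨ sgn-+ (+ j) n ⟨
      sgn (+ j + n)               ∎
      where
      open ≡-Reasoning
      n = nVector 0 xs j

    ∑-sgn-level : ∀ m {xs} → Linked (λ a b → b ℕ.≤ a) xs → ¬ RimHookSpan xs t →
                  ∑[ i < t ] sgn (level m xs i) ≡ sgn (+ m) * (1ℤ - + 4 * bgAux 0 xs)
    ∑-sgn-level m {[]}     _      _       =
      trans (∑-cong t (λ i _ → cong sgn (ℤ.+-identityʳ (base m i))))
            (trans (∑-sgn-base m) (sym (ℤ.*-identityʳ (sgn (+ m)))))
    ∑-sgn-level m {x ∷ xs} linked no-span = begin
      ∑[ i < t ] sgn (level m (x ∷ xs) i)
        ≡⟨ ∑-cong t (λ i i<t → cong sgn (level-∷ m x xs i<t)) ⟩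
      ∑[ i < t ] sgn (level (suc m) xs i + δ ρ i * + t)
        ≡⟨ ∑-sgn-flip (level (suc m) xs) (n%ℕd<d X t) ⟩
      ∑[ i < t ] sgn (level (suc m) xs i) - + 2 * sgn (level (suc m) xs ρ)
        ≡⟨ cong₂ (λ a e → a - + 2 * sgn e) (∑-sgn-level (suc m) tail-linked tail-no-span) (sym top) ⟩
      sgn (+ suc m) * (1ℤ - + 4 * b) - + 2 * sgn X
        ≡⟨ cong₂ (λ a e → a * (1ℤ - + 4 * b) - + 2 * e) (sgn-suc m) sgn-X ⟩
      - s * (1ℤ - + 4 * b) - + 2 * (- (s * (1ℤ - + 2 * p)))
        ≡⟨ regroup s b p ⟩
      s * (1ℤ - + 4 * (p + - b))
        ≡⟨ cong (λ e → s * (1ℤ - + 4 * (p + e))) (bgAux-1≡-bgAux-0 xs) ⟨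
      s * (1ℤ - + 4 * bgAux 0 (x ∷ xs))                    ∎
      where
      open ≡-Reasoning
      X = + x - + suc m
      ρ = X %ℕ t
      s = sgn (+ m)
      b = bgAux 0 xs
      p = + (x ℕ.% 2)
      tail-linked = Linked.tail linked
      tail-no-span = ¬RimHookSpan-∷ no-span
      top : X ≡ level (suc m) xs ρ
      top = first-bead-at-level {L = level (suc m) xs}
              (core⇒FilledBelow-level (suc m) tail-linked tail-no-span) (λ i → level-res (suc m) xs) linked no-span
      sgn-X : sgn X ≡ - (s * (1ℤ - + 2 * p))
      sgn-X = begin
        sgn (+ x + - + suc m)
          ≡⟨ sgn-+ (+ x) (- + suc m) ⟩
        sgn (+ x) * sgn (- + suc m)
          ≡⟨ cong₂ _*_ (sgn-parity x) (trans (sgn-neg (+ suc m)) (sgn-suc m)) ⟩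
        (1ℤ - + 2 * p) * - s
          ≡⟨ swap (1ℤ - + 2 * p) s ⟩
        - (s * (1ℤ - + 2 * p))            ∎
        where
        swap : ∀ a s → a * - s ≡ - (s * a)
        swap = solve-∀
      regroup : ∀ s b p →
                - s * (1ℤ - + 4 * b) - + 2 * (- (s * (1ℤ - + 2 * p))) ≡ s * (1ℤ - + 4 * (p + - b))
      regroup = solve-∀

mainTheorem6 : (t : ℕ) .{{_ : NonZero t}} → t % 2 ≡ 1 → (π : Partition) → IsCore t π →
    (+ 4) ℤ.* BGrank π
      ≡ (+ 1) ℤ.- sumℤ (map (λ j → sgn ((+ j) ℤ.+ nDiff t π j)) (upTo t))
mainTheorem6 t t-odd π core = begin
  + 4 * bgAux 0 xs                                          ≡⟨ double-negation (+ 4 * bgAux 0 xs) ⟩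
  1ℤ - (1ℤ - + 4 * bgAux 0 xs)                              ≡⟨ cong (λ e → 1ℤ - e) levels ⟨
  1ℤ - ∑[ j < t ] sgn (level 0 xs j)                        ≡⟨ cong (λ e → 1ℤ - e) (∑-cong t sgn-level) ⟩
  1ℤ - ∑[ j < t ] sgn (+ j + nDiff t π j)                   ≡⟨ cong (λ e → 1ℤ - e) (sumℤ-map-upTo _ t) ⟨
  1ℤ - sumℤ (map (λ j → sgn (+ j + nDiff t π j)) (upTo t))  ∎
  where
  open ≡-Reasoning
  open Abacus t
  open Signs t-odd
  xs = parts π
  double-negation : ∀ z → z ≡ 1ℤ - (1ℤ - z)
  double-negation = solve-∀
  levels : ∑[ j < t ] sgn (level 0 xs j) ≡ 1ℤ - + 4 * bgAux 0 xs
  levels = trans (∑-sgn-level 0 (decreasing π) (core ∘ rimHookSpan⇒hasRimHook {π})) (ℤ.*-identityˡ _)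
  sgn-level : ∀ j → j ℕ.< t → sgn (level 0 xs j) ≡ sgn (+ j + nDiff t π j)
  sgn-level j j<t = trans (sgn-level-zero xs j<t) (cong (λ n → sgn (+ j + n)) (sym (nDiff≡nVector π j<t)))
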